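{- For every integer $n\geq 0$, the generating polynomial of the $n$-foil is $F_n(x)=(x+1)^n+x^2-1$.
   Context: A shadow is a finite union of closed curves in the plane in general position: finitely many self-intersections, called crossings, all transverse double points. Splitting a crossing means deleting a small neighbourhood of it and reconnecting the four loose ends by two disjoint arcs (two possible ways). A state of a shadow with $m$ crossings is the result of splitting every crossing in one of the two ways ($2^m$ states); it is a disjoint union of simple closed curves, and $|S|$ is the number of curves. The generating polynomial of a shadow $D$ is $D(x)=\sum_S x^{|S|}$ over all states. For $n\geq 0$ let $R_n$ be a horizontal twist region: two strands running left to right that cross each other $n$ times consecutively (for $n=0$ two parallel segments), with left ends NW (upper), SW (lower) and right ends NE, SE. The $n$-foil $F_n$ is the shadow obtained from $R_n$ by joining NW to NE by an arc passing above $R_n$ and SW to SE by an arc passing below $R_n$, i.e. the standard shadow of the $(2,n)$-torus knot or link; $F_0$ consists of two disjoint circles (so $F_0(x)=x^2$). -}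

module Defs where

open import Data.Nat using (ℕ; zero; suc; _+_)
open import Data.Integer using (ℤ; +_; _*_) renaming (_+_ to _+ℤ_)
open import Data.Integer using () renaming (_^_ to _^ℤ_)
open import Data.Vec using (Vec; []; _∷_)
open import Data.List using (List; []; _∷_; map; _++_; foldr)

-- A piece of a state lying in a disk with four boundary points
-- NW, SW (left) and NE, SE (right) consists of two disjoint arcs joining
-- these four points in pairs, plus some number of closed curves inside
-- the disk.  Planarity (disjointness of the arcs) leaves exactly two
-- pairings of the endpoints:
--   horiz : arcs NW–NE and SW–SE
--   vert  : arcs NW–SW and NE–SE
-- (the third pairing NW–SE, SW–NE is the crossing itself and is not
-- realisable by disjoint arcs).

data Pairing : Set where
  horiz vert : Pairing

record Tangle : Set where
  constructor tangle
  field
    pairing : Pairing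
    loops   : ℕ
open Tangle public

-- Splitting one crossing of R_n (the crossing pairs NW with SE and SW
-- with NE) in one of the two possible ways: the resulting piece is one
-- of the two pairings, with no closed curves.
split : Pairing → Tangle
split p = tangle p 0

-- R_0: two parallel segments.
parallel : Tangle
parallel = tangle horiz 0

-- Placing tangle s to the left of tangle t, gluing NE of s to NW of t
-- and SE of s to SW of t.
glue : Tangle → Tangle → Tangle
glue (tangle horiz a) (tangle q b)     = tangle q (a + b)
glue (tangle vert a)  (tangle horiz b) = tangle vert (a + b)
-- NE–SE arc of s and NW–SW arc of t close up into one new curve
glue (tangle vert a)  (tangle vert b)  = tangle vert (suc (a + b))

-- The state of R_n obtained by splitting its n consecutive crossings
-- (listed left to right) in the given ways.
twistState : {n : ℕ} → Vec Pairing n → Tangle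
twistState []       = parallel
twistState (p ∷ ps) = glue (split p) (twistState ps)

-- Foil closure: join NW to NE by an arc above and SW to SE by an arc
-- below; returns the total number of curves of the resulting state.
foilClosure : Tangle → ℕ
foilClosure (tangle horiz a) = 2 + a   -- each arc closes into a curve
foilClosure (tangle vert a)  = 1 + a   -- NW–SW, SW–SE, SE–NE, NE–NW: one curve

allChoices : (n : ℕ) → List (Vec Pairing n)
allChoices zero    = [] ∷ []
allChoices (suc n) = map (horiz ∷_) (allChoices n) ++ map (vert ∷_) (allChoices n)

sumℤ : List ℤ → ℤ
sumℤ = foldr _+ℤ_ (+ 0)

foilStateCurves : {n : ℕ} → Vec Pairing n → ℕ
foilStateCurves s = foilClosure (twistState s)

-- Generating polynomial F_n(x) = Σ_S x^{|S|}, evaluated at an integer x.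
foilPoly : ℕ → ℤ → ℤ
foilPoly n x = sumℤ (map (λ s → x ^ℤ foilStateCurves s) (allChoices n))

module Submission where

-- Every state of the twist region R_n is a tangle: one of the
-- two pairings (horiz or vert) of its four ends, plus some closed loops.
-- Record the states of R_n by two "bracket" sums
--   H_n = Σ_{horiz states} x^loops ,   V_n = Σ_{vert states} x^loops .
-- Adding a crossing on the left and splitting it horizontally leaves a
-- state unchanged; splitting it vertically turns every horiz state into a
-- vert one and closes one extra loop on every vert state.  Hence
--   H_{n+1} = H_n ,   V_{n+1} = V_n + H_n + x·V_n ,
-- so H_n = 1 and x·V_n = (x+1)^n − 1 by induction.  The foil closure turns
-- a horiz state into loops+2 curves and a vert one into loops+1 curves, so
--   F_n(x) = x²·H_n + x·V_n = (x+1)^n + x² − 1 .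

open import Defs
open import Data.Nat using (ℕ; zero; suc)
open import Data.Integer using (ℤ; +_; _+_; _-_; _^_; _*_)
open import Data.Integer.Properties using (+-identityˡ; +-assoc)
open import Data.Integer.Solver using (module +-*-Solver)
open import Data.Vec using (Vec; _∷_)
open import Data.List using (List; []; _∷_; map; _++_)
open import Data.List.Properties using (map-++; map-∘; map-cong)
open import Relation.Binary.PropositionalEquality
open ≡-Reasoning
open +-*-Solver

sumℤ-++ : (xs ys : List ℤ) → sumℤ (xs ++ ys) ≡ sumℤ xs + sumℤ ys
sumℤ-++ []       ys = sym (+-identityˡ (sumℤ ys))
sumℤ-++ (x ∷ xs) ys = begin
  x + sumℤ (xs ++ ys)   ≡⟨ cong (λ r → x + r) (sumℤ-++ xs ys) ⟩
  x + (sumℤ xs + sumℤ ys)         ≡⟨ sym (+-assoc x (sumℤ xs) (sumℤ ys)) ⟩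
  x + sumℤ xs + sumℤ ys           ∎

sumℤ-linear : {A : Set} (c d : ℤ) (f g : A → ℤ) (xs : List A) →
  sumℤ (map (λ a → c * f a + d * g a) xs) ≡ c * sumℤ (map f xs) + d * sumℤ (map g xs)
sumℤ-linear c d f g [] =
  solve 2 (λ c d → con (+ 0) := c :* con (+ 0) :+ d :* con (+ 0)) refl c d
sumℤ-linear c d f g (a ∷ xs) =
  begin
    c * f a + d * g a + sumℤ (map (λ a → c * f a + d * g a) xs)
  ≡⟨ cong (λ r → c * f a + d * g a + r) (sumℤ-linear c d f g xs) ⟩
    c * f a + d * g a + (c * F + d * G)
  ≡⟨ solve 6 (λ c d u v F G → c :* u :+ d :* v :+ (c :* F :+ d :* G)
                            := c :* (u :+ F) :+ d :* (v :+ G)) refl c d (f a) (g a) F G ⟩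
    c * (f a + F) + d * (g a + G)
  ∎
  where
  F G : ℤ
  F = sumℤ (map f xs)
  G = sumℤ (map g xs)

sumℤ-zeros : {A : Set} (xs : List A) → sumℤ (map (λ _ → + 0) xs) ≡ + 0
sumℤ-zeros []       = refl
sumℤ-zeros (_ ∷ xs) = cong (λ r → + 0 + r) (sumℤ-zeros xs)

stateSum : ℕ → (Tangle → ℤ) → ℤ
stateSum n w = sumℤ (map (λ s → w (twistState s)) (allChoices n))

-- The states of R_{n+1} are those of R_n with the leftmost crossing split
-- horizontally or vertically glued on.
stateSum-suc : (n : ℕ) (w : Tangle → ℤ) →
  stateSum (suc n) w ≡ stateSum n (λ t → w (glue (split horiz) t))
                     + stateSum n (λ t → w (glue (split vert) t))
stateSum-suc n w = begin
    sumℤ (map W (map (horiz ∷_) cs ++ map (vert ∷_) cs))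
  ≡⟨ cong sumℤ (map-++ W (map (horiz ∷_) cs) (map (vert ∷_) cs)) ⟩
    sumℤ (map W (map (horiz ∷_) cs) ++ map W (map (vert ∷_) cs))
  ≡⟨ sumℤ-++ (map W (map (horiz ∷_) cs)) (map W (map (vert ∷_) cs)) ⟩
    sumℤ (map W (map (horiz ∷_) cs)) + sumℤ (map W (map (vert ∷_) cs))
  ≡⟨ sym (cong₂ (λ p q → sumℤ p + sumℤ q) (map-∘ cs) (map-∘ cs)) ⟩
    stateSum n (λ t → w (glue (split horiz) t)) + stateSum n (λ t → w (glue (split vert) t))
  ∎
  where
  cs : List (Vec Pairing n)
  cs = allChoices n
  W : Vec Pairing (suc n) → ℤ
  W s = w (twistState s)

stateSum-cong : (n : ℕ) {v w : Tangle → ℤ} → (∀ t → v t ≡ w t) → stateSum n v ≡ stateSum n w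
stateSum-cong n v≗w = cong sumℤ (map-cong (λ s → v≗w (twistState s)) (allChoices n))

stateSum-linear : (n : ℕ) (c d : ℤ) (v w : Tangle → ℤ) →
  stateSum n (λ t → c * v t + d * w t) ≡ c * stateSum n v + d * stateSum n w
stateSum-linear n c d v w =
  sumℤ-linear c d (λ s → v (twistState s)) (λ s → w (twistState s)) (allChoices n)

module Brackets (x : ℤ) where

  horizWeight vertWeight : Tangle → ℤ
  horizWeight (tangle horiz a) = x ^ a
  horizWeight (tangle vert  a) = + 0
  vertWeight  (tangle horiz a) = + 0
  vertWeight  (tangle vert  a) = x ^ a

  H V : ℕ → ℤ
  H n = stateSum n horizWeight
  V n = stateSum n vertWeight

  horizWeight-horiz : ∀ t → horizWeight (glue (split horiz) t) ≡ horizWeight t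
  horizWeight-horiz (tangle horiz a) = refl
  horizWeight-horiz (tangle vert  a) = refl

  vertWeight-horiz : ∀ t → vertWeight (glue (split horiz) t) ≡ vertWeight t
  vertWeight-horiz (tangle horiz a) = refl
  vertWeight-horiz (tangle vert  a) = refl

  horizWeight-vert : ∀ t → horizWeight (glue (split vert) t) ≡ + 0
  horizWeight-vert (tangle horiz a) = refl
  horizWeight-vert (tangle vert  a) = refl

  vertWeight-vert : ∀ t → vertWeight (glue (split vert) t) ≡ + 1 * horizWeight t + x * vertWeight t
  vertWeight-vert (tangle horiz a) =
    solve 2 (λ x y → y := con (+ 1) :* y :+ x :* con (+ 0)) refl x (x ^ a)
  vertWeight-vert (tangle vert  a) =
    solve 2 (λ x y → x :* y := con (+ 1) :* con (+ 0) :+ x :* y) refl x (x ^ a)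

  -- Only the all-horizontal state is horiz, and it has no loops.
  H≡1 : ∀ n → H n ≡ + 1
  H≡1 zero    = refl
  H≡1 (suc n) = begin
    H (suc n)                                              ≡⟨ stateSum-suc n horizWeight ⟩
    stateSum n (λ t → horizWeight (glue (split horiz) t))
      + stateSum n (λ t → horizWeight (glue (split vert) t)) ≡⟨ cong₂ _+_ (stateSum-cong n horizWeight-horiz)
                                                                         (stateSum-cong n horizWeight-vert) ⟩
    H n + stateSum n (λ _ → + 0)                            ≡⟨ cong₂ _+_ (H≡1 n) (sumℤ-zeros (allChoices n)) ⟩
    + 1                                                     ∎

  V-suc : ∀ n → V (suc n) ≡ V n + (+ 1 * H n + x * V n)
  V-suc n = begin
    V (suc n)                                               ≡⟨ stateSum-suc n vertWeight ⟩
    stateSum n (λ t → vertWeight (glue (split horiz) t))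
      + stateSum n (λ t → vertWeight (glue (split vert) t)) ≡⟨ cong₂ _+_ (stateSum-cong n vertWeight-horiz)
                                                                         (stateSum-cong n vertWeight-vert) ⟩
    V n + stateSum n (λ t → + 1 * horizWeight t + x * vertWeight t)
                                                            ≡⟨ cong (λ r → V n + r) (stateSum-linear n (+ 1) x horizWeight vertWeight) ⟩
    V n + (+ 1 * H n + x * V n)                             ∎

  xV≡ : ∀ n → x * V n ≡ (x + + 1) ^ n - + 1
  xV≡ zero    = solve 1 (λ x → x :* con (+ 0) := con (+ 1) :- con (+ 1)) refl x
  xV≡ (suc n) = begin
    x * V (suc n)                        ≡⟨ cong (x *_) (V-suc n) ⟩
    x * (V n + (+ 1 * H n + x * V n))    ≡⟨ cong (λ h → x * (V n + (+ 1 * h + x * V n))) (H≡1 n) ⟩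
    x * (V n + (+ 1 * + 1 + x * V n))    ≡⟨ solve 2 (λ x v → x :* (v :+ (con (+ 1) :* con (+ 1) :+ x :* v))
                                                       := (x :+ con (+ 1)) :* (x :* v) :+ x) refl x (V n) ⟩
    (x + + 1) * (x * V n) + x            ≡⟨ cong (λ y → (x + + 1) * y + x) (xV≡ n) ⟩
    (x + + 1) * ((x + + 1) ^ n - + 1) + x ≡⟨ solve 2 (λ x y → (x :+ con (+ 1)) :* (y :- con (+ 1)) :+ x
                                                        := (x :+ con (+ 1)) :* y :- con (+ 1)) refl x ((x + + 1) ^ n) ⟩
    (x + + 1) ^ suc n - + 1              ∎

  foilWeight : ∀ t → x ^ foilClosure t ≡ x ^ 2 * horizWeight t + x * vertWeight t
  foilWeight (tangle horiz a) =
    solve 2 (λ x y → x :* (x :* y) := (x :* (x :* con (+ 1))) :* y :+ x :* con (+ 0)) refl x (x ^ a)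
  foilWeight (tangle vert a) =
    solve 2 (λ x y → x :* y := (x :* (x :* con (+ 1))) :* con (+ 0) :+ x :* y) refl x (x ^ a)

open Brackets

mainTheorem7 : (n : ℕ) (x : ℤ) → foilPoly n x ≡ (x + + 1) ^ n + x ^ 2 - + 1
mainTheorem7 n x = begin
  foilPoly n x                                         ≡⟨ stateSum-cong n (foilWeight x) ⟩
  stateSum n (λ t → x ^ 2 * horizWeight x t + x * vertWeight x t)
                                                       ≡⟨ stateSum-linear n (x ^ 2) x (horizWeight x) (vertWeight x) ⟩
  x ^ 2 * H x n + x * V x n                            ≡⟨ cong₂ (λ h v → x ^ 2 * h + v) (H≡1 x n) (xV≡ x n) ⟩
  x ^ 2 * + 1 + ((x + + 1) ^ n - + 1)                  ≡⟨ solve 2 (λ x y → (x :* (x :* con (+ 1))) :* con (+ 1) :+ (y :- con (+ 1))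
                                                                       := y :+ x :* (x :* con (+ 1)) :- con (+ 1)) refl x ((x + + 1) ^ n) ⟩
  (x + + 1) ^ n + x ^ 2 - + 1                          ∎
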